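{- Let $k\ge 3$ and let $f:\mathbb{Z}\times\mathbb{Z}\to\mathbb{Z}$ be a function with $f(\ell,\ell)=1$ for every $\ell$, such that $f(s_1,\ell)<f(s_2,\ell)$ whenever $s_1>s_2$. For a rank $k$ hypergraph $\mathcal{F}$, the $f$-reduction $\mathcal{F}'$ of $\mathcal{F}$ satisfies: (1) for every $2\leq s<\ell\leq k$, $\delta_{s,\ell}(\mathcal{F}')\leq f(s,\ell)$; (2) any proper coloring of $\mathcal{F}'$ is also a proper coloring of $\mathcal{F}$. Moreover, if $\mathcal{F}$ is triangle-free, then $\mathcal{F}'$ is also triangle-free.
   Context: A hypergraph is a pair $(V,E)$ with $E$ a family of subsets of $V$; rank $k$ means every edge has between $2$ and $k$ vertices. A proper coloring is a vertex coloring with no monochromatic edge. For a vertex set $S$, $\deg_\ell(S,\mathcal{F})$ is the number of edges of size exactly $\ell$ containing $S$, and $\delta_{s,\ell}(\mathcal{F})$ is the maximum of $\deg_\ell(S,\mathcal{F})$ over $s$-element sets $S$. A triangle is a set of three distinct edges $e,f,g$ and three distinct vertices $u,v,w$ with $\{u,v\}\subseteq e$, $\{v,w\}\subseteq f$, $\{w,u\}\subseteq g$ and $\{u,v,w\}\cap e\cap f\cap g=\emptyset$; triangle-free means containing no triangle. The $f$-reduction of a rank $k$ hypergraph $\mathcal{F}$ is defined by the following procedure. Let $V=V(\mathcal{F})$ and $\mathcal{F}^0=\mathcal{F}$. For $i=1,2,\dots,k-2$: for every vertex $u$ and every $\ell$ with $2\le k-i<\ell\le k$, let $F_{k-i,\ell}(u)=\{S\subseteq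 V: |S|=k-i,\ u\in S,\ \deg_\ell(S,\mathcal{F}^{i-1})\ge f(k-i,\ell)\}$, and define $\mathcal{F}^i$ on vertex set $V$ by $E(\mathcal{F}^i)=E(\mathcal{F}^{i-1})\ \setminus\ \bigcup_u\bigcup_{\ell>k-i}\bigcup_{S\in F_{k-i,\ell}(u)}\{e\in\mathcal{F}^{i-1}: e\supseteq S,\ |e|=\ell\}\ \cup\ \bigcup_u\bigcup_{\ell>k-i}F_{k-i,\ell}(u)$ (i.e. all size-$\ell$ edges containing such a heavy set $S$ are removed and $S$ itself is added as an edge). The $f$-reduction is $\mathcal{F}'=\mathcal{F}^{k-2}$. -}

module Defs where

open import Data.Bool using (Bool; true; false; _∧_; _∨_; not)
open import Data.Nat using (ℕ; zero; suc; _≤_; _<_; _∸_; _≡ᵇ_; _<ᵇ_; _≤ᵇ_; _⊔_)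
open import Data.Integer as ℤ using (ℤ; +_)
open import Data.Fin using (Fin)
open import Data.Fin.Subset using (Subset; ∣_∣; _∈_; _⊆_)
open import Data.Fin.Subset.Properties using (_⊆?_)
open import Data.List using (List; []; _∷_; map; _++_; length; filterᵇ; foldr; upTo)
open import Data.Bool.ListAction using (any)
open import Data.Vec using (Vec; []; _∷_)
open import Data.Product using (_×_; ∃)
open import Relation.Nullary using (¬_; does)
open import Relation.Binary.PropositionalEquality using (_≡_; _≢_)

Hypergraph : ℕ → Set
Hypergraph n = Subset n → Bool

IsEdge : ∀ {n} → Hypergraph n → Subset n → Set
IsEdge H e = H e ≡ true

Rank : ∀ {n} → ℕ → Hypergraph n → Set
Rank k H = ∀ e → IsEdge H e → 2 ≤ ∣ e ∣ × ∣ e ∣ ≤ k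

allSubsets : ∀ n → List (Subset n)
allSubsets zero = [] ∷ []
allSubsets (suc n) = map (true ∷_) (allSubsets n) ++ map (false ∷_) (allSubsets n)

deg : ∀ {n} → ℕ → Subset n → Hypergraph n → ℕ
deg {n} ℓ S H = length (filterᵇ (λ e → H e ∧ (does (S ⊆? e) ∧ (∣ e ∣ ≡ᵇ ℓ))) (allSubsets n))

δ : ∀ {n} → ℕ → ℕ → Hypergraph n → ℕ
δ {n} s ℓ H = foldr _⊔_ 0 (map (λ S → deg ℓ S H) (filterᵇ (λ S → ∣ S ∣ ≡ᵇ s) (allSubsets n)))

heavyFor : ∀ {n} → (ℤ → ℤ → ℤ) → Hypergraph n → ℕ → ℕ → Subset n → Bool
heavyFor f H s ℓ S = does (f (+ s) (+ ℓ) ℤ.≤? + deg ℓ S H)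

-- one reduction step with set size s (= k - i), applied to H = F^{i-1}
-- S ∈ F_{s,ℓ}(u) for some u: |S| = s, s < ℓ ≤ k, deg_ℓ(S,H) ≥ f(s,ℓ)
-- (u ∈ S for some u is automatic since s ≥ 2)
heavy : ∀ {n} → ℕ → (ℤ → ℤ → ℤ) → Hypergraph n → ℕ → ℕ → Subset n → Bool
heavy k f H s ℓ S = (∣ S ∣ ≡ᵇ s) ∧ ((s <ᵇ ℓ) ∧ ((ℓ ≤ᵇ k) ∧ heavyFor f H s ℓ S))

removed : ∀ {n} → ℕ → (ℤ → ℤ → ℤ) → Hypergraph n → ℕ → Subset n → Bool
removed {n} k f H s e = any (λ S → does (S ⊆? e) ∧ heavy k f H s ∣ e ∣ S) (allSubsets n)

added : ∀ {n} → ℕ → (ℤ → ℤ → ℤ) → Hypergraph n → ℕ → Subset n → Bool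
added k f H s e = any (λ ℓ → heavy k f H s ℓ e) (upTo (suc k))

step : ∀ {n} → ℕ → (ℤ → ℤ → ℤ) → Hypergraph n → ℕ → Hypergraph n
step k f H s e = (H e ∧ not (removed k f H s e)) ∨ added k f H s e

reductionStage : ∀ {n} → ℕ → (ℤ → ℤ → ℤ) → Hypergraph n → ℕ → Hypergraph n
reductionStage k f F zero = F
reductionStage k f F (suc i) = step k f (reductionStage k f F i) (k ∸ suc i)

reduction : ∀ {n} → ℕ → (ℤ → ℤ → ℤ) → Hypergraph n → Hypergraph n
reduction k f F = reductionStage k f F (k ∸ 2)

Monochromatic : ∀ {n} {A : Set} → (Fin n → A) → Subset n → Set
Monochromatic c e = ∀ u v → u ∈ e → v ∈ e → c u ≡ c v

ProperColoring : ∀ {n} {A : Set} → Hypergraph n → (Fin n → A) → Set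
ProperColoring H c = ∀ e → IsEdge H e → ¬ Monochromatic c e

IsTriangle : ∀ {n} → Hypergraph n → Subset n → Subset n → Subset n → Fin n → Fin n → Fin n → Set
IsTriangle H e f g u v w =
  (IsEdge H e × IsEdge H f × IsEdge H g) ×
  (e ≢ f × f ≢ g × e ≢ g) ×
  (u ≢ v × v ≢ w × u ≢ w) ×
  ((u ∈ e × v ∈ e) × (v ∈ f × w ∈ f) × (w ∈ g × u ∈ g)) ×
  (¬ (u ∈ e × u ∈ f × u ∈ g) × ¬ (v ∈ e × v ∈ f × v ∈ g) × ¬ (w ∈ e × w ∈ f × w ∈ g))

TriangleFree : ∀ {n} → Hypergraph n → Set
TriangleFree H = ∀ e f g u v w → ¬ IsTriangle H e f g u v w

{-# OPTIONS --safe #-}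
module Submission where

-- The reduction treats the set sizes s = k-1, …, 2 in turn. After the
-- round for size s, every s-set S has deg_ℓ(S) < f(s,ℓ): a heavy S loses all its
-- ℓ-edges, and later rounds only add edges of size below s, so no deg_ℓ with
-- ℓ > s grows again. Each removed edge contains the heavy set that replaces it,
-- which gives the colouring statement. For triangles: if a round adds X (heavy for ℓ)
-- and w ∉ X, then X ∪ {w} lies in fewer ℓ-edges than X, by the invariant and
-- monotonicity of f, or because f(ℓ,ℓ) = 1; so some ℓ-edge contains X and misses w.
-- Enlarging the three edges of a triangle this way gives a triangle one stage earlier.

open import Defs
open import Data.Bool using (Bool; true; false; T; T?; _∧_; not)
open import Data.Bool.Properties using (T-≡; T-∧; T-∨)
open import Data.Empty using (⊥-elim)
open import Data.Fin using (Fin)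
open import Data.Fin.Subset using (Subset; ∣_∣; _∈_; _∉_; _⊆_; _⊂_; _∪_; ⁅_⁆)
open import Data.Fin.Subset.Properties
  using (_⊆?_; _∈?_; ⊆-antisym; p⊂q⇒∣p∣<∣q∣; p⊆p∪q; q⊆p∪q; x∈⁅x⁆; x∈p∪q⁻; x∈⁅y⁆⇒x≡y)
open import Data.Integer as ℤ using (ℤ; +_)
import Data.Integer.Properties as ℤₚ
open import Data.List using ([]; _∷_; map; length; filterᵇ; upTo)
open import Data.List.Membership.Propositional using (lose) renaming (_∈_ to _∈ₗ_)
open import Data.List.Membership.Propositional.Properties
  using (∈-++⁺ˡ; ∈-++⁺ʳ; ∈-map⁺; ∈-map⁻; ∈-upTo⁺)
open import Data.List.Properties using (foldr-preservesᵇ; filter-none)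
open import Data.List.Relation.Binary.Sublist.Propositional using (⊆-refl)
open import Data.List.Relation.Binary.Sublist.Propositional.Properties
  using (filter⁺; length-mono-≤)
open import Data.List.Relation.Unary.All as All using (All; []; _∷_)
open import Data.List.Relation.Unary.All.Properties using (all-filter) renaming (map⁺ to All-map⁺)
open import Data.List.Relation.Unary.AllPairs using ([]; _∷_)
open import Data.List.Relation.Unary.Any using (here; satisfied)
open import Data.List.Relation.Unary.Any.Properties using (any⁺; any⁻)
open import Data.List.Relation.Unary.Unique.Propositional using (Unique)
import Data.List.Relation.Unary.Unique.Propositional.Properties as Unique
open import Data.Nat using (ℕ; zero; suc; _≤_; _<_; _∸_; _⊔_; _≡ᵇ_; z≤n; s≤s; s≤s⁻¹)
open import Data.Nat.Properties as ℕₚ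
  using (≡ᵇ⇒≡; ≡⇒≡ᵇ; <ᵇ⇒<; <⇒<ᵇ; ≤ᵇ⇒≤; ≤⇒≤ᵇ; ⊔-sel; <⇒≢; <⇒≱; m∸[m∸n]≡n)
open import Data.Product using (_×_; _,_; ∃; proj₁; proj₂)
open import Data.Vec using ([]; _∷_)
open import Data.Sum using (_⊎_; inj₁; inj₂)
open import Function using (_∘_)
open import Function.Bundles using (Equivalence)
open import Relation.Nullary using (¬_; Dec; yes; no; does)
open import Relation.Nullary.Decidable using (dec-true; decidable-stable)
open import Relation.Binary.PropositionalEquality
  using (_≡_; _≢_; refl; sym; trans; cong; subst; ≢-sym)

open Equivalence using (to; from)

T-does⁻ : ∀ {P : Set} (P? : Dec P) → T (does P?) → P
T-does⁻ (yes p) _ = p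

T-does⁺ : ∀ {P : Set} (P? : Dec P) → P → T (does P?)
T-does⁺ P? p = from T-≡ (dec-true P? p)

T-not⁻ : ∀ {b} → T (not b) → ¬ T b
T-not⁻ {false} _ ()

T-not⁺ : ∀ {b} → ¬ T b → T (not b)
T-not⁺ {false} _   = _
T-not⁺ {true}  ¬tt = ¬tt _

⊔-closed : ∀ {ℓ} (P : ℕ → Set ℓ) {m n} → P m → P n → P (m ⊔ n)
⊔-closed P {m} {n} pm pn with ⊔-sel m n
... | inj₁ eq = subst P (sym eq) pm
... | inj₂ eq = subst P (sym eq) pn

m∸n≤1+[m∸1+n] : ∀ m n → m ∸ n ≤ suc (m ∸ suc n)
m∸n≤1+[m∸1+n] zero    zero    = z≤n
m∸n≤1+[m∸1+n] zero    (suc n) = z≤n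
m∸n≤1+[m∸1+n] (suc m) zero    = ℕₚ.≤-refl
m∸n≤1+[m∸1+n] (suc m) (suc n) = m∸n≤1+[m∸1+n] m n

module _ {A : Set} (p q : A → Bool) where

  count-mono : (∀ {x} → T (p x) → T (q x)) →
               ∀ xs → length (filterᵇ p xs) ≤ length (filterᵇ q xs)
  count-mono p⇒q xs =
    length-mono-≤ (filter⁺ (T? ∘ p) (T? ∘ q) (λ { refl → p⇒q }) (⊆-refl {x = xs}))

  count-<⇒witness : ∀ xs → length (filterᵇ q xs) < length (filterᵇ p xs) →
                    ∃ λ x → T (p x) × ¬ T (q x)
  count-<⇒witness (x ∷ xs) lt with p x in px | q x in qx
  ... | true  | false = x , subst T (sym px) _ , subst T qx
  ... | true  | true  = count-<⇒witness xs (s≤s⁻¹ lt)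
  ... | false | true  = count-<⇒witness xs (ℕₚ.<-trans (ℕₚ.n<1+n _) lt)
  ... | false | false = count-<⇒witness xs lt

unique-const-≤1 : ∀ {A : Set} {U : A} {xs} → Unique xs → All (_≡ U) xs → length xs ≤ 1
unique-const-≤1 {xs = []}        _                 _                 = z≤n
unique-const-≤1 {xs = _ ∷ []}    _                 _                 = s≤s z≤n
unique-const-≤1 {xs = _ ∷ _ ∷ _} ((x≢y ∷ _) ∷ _) (refl ∷ refl ∷ _) = ⊥-elim (x≢y refl)

count-≤1 : ∀ {A : Set} (p : A → Bool) {U : A} {xs} → Unique xs →
           (∀ {x} → T (p x) → x ≡ U) → length (filterᵇ p xs) ≤ 1
count-≤1 p {xs = xs} uniq p⇒U =
  unique-const-≤1 (Unique.filter⁺ (T? ∘ p) uniq) (All.map p⇒U (all-filter (T? ∘ p) xs))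

allSubsets-complete : ∀ {n} (e : Subset n) → e ∈ₗ allSubsets n
allSubsets-complete []                = here refl
allSubsets-complete {suc n} (true ∷ e)  = ∈-++⁺ˡ (∈-map⁺ (true ∷_) (allSubsets-complete e))
allSubsets-complete {suc n} (false ∷ e) =
  ∈-++⁺ʳ (map (true ∷_) (allSubsets n)) (∈-map⁺ (false ∷_) (allSubsets-complete e))

allSubsets-unique : ∀ n → Unique (allSubsets n)
allSubsets-unique zero    = [] ∷ []
allSubsets-unique (suc n) =
  Unique.++⁺ (Unique.map⁺ tail-injective (allSubsets-unique n))
             (Unique.map⁺ tail-injective (allSubsets-unique n))
             disjoint
  where
  tail-injective : ∀ {b} {x y : Subset n} → b ∷ x ≡ b ∷ y → x ≡ y
  tail-injective refl = refl
  disjoint : ∀ {e} → ¬ (e ∈ₗ map (true ∷_) (allSubsets n) × e ∈ₗ map (false ∷_) (allSubsets n))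
  disjoint (e∈ᵗ , e∈ᶠ) with ∈-map⁻ (true ∷_) e∈ᵗ | ∈-map⁻ (false ∷_) e∈ᶠ
  ... | _ , _ , refl | _ , _ , ()

⊆∧∣∣≥⇒≡ : ∀ {n} {p q : Subset n} → p ⊆ q → ∣ q ∣ ≤ ∣ p ∣ → p ≡ q
⊆∧∣∣≥⇒≡ {p = p} p⊆q ∣q∣≤∣p∣ = ⊆-antisym p⊆q λ {x} x∈q →
  decidable-stable (x ∈? p) λ x∉p → <⇒≱ (p⊂q⇒∣p∣<∣q∣ (p⊆q , x , x∈q , x∉p)) ∣q∣≤∣p∣

∪⁅⁆-⊆ : ∀ {n} {X e : Subset n} {w} → X ⊆ e → w ∈ e → X ∪ ⁅ w ⁆ ⊆ e
∪⁅⁆-⊆ {X = X} {w = w} X⊆e w∈e x∈ with x∈p∪q⁻ X ⁅ w ⁆ x∈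
... | inj₁ x∈X = X⊆e x∈X
... | inj₂ x∈w = subst (_∈ _) (sym (x∈⁅y⁆⇒x≡y w x∈w)) w∈e

∈∧∉⇒≢ : ∀ {n} {x : Fin n} {p q} → x ∈ p → x ∉ q → p ≢ q
∈∧∉⇒≢ x∈p x∉p refl = x∉p x∈p

-- The filter predicate in the definition of deg, so that deg ℓ S H is
-- definitionally the number of subsets passing degTest ℓ S H.
degTest : ∀ {n} → ℕ → Subset n → Hypergraph n → Subset n → Bool
degTest ℓ S H e = H e ∧ (does (S ⊆? e) ∧ (∣ e ∣ ≡ᵇ ℓ))

Counted : ∀ {n} → ℕ → Subset n → Hypergraph n → Subset n → Set
Counted ℓ S H e = IsEdge H e × S ⊆ e × ∣ e ∣ ≡ ℓ

degTest⁻ : ∀ {n} ℓ S (H : Hypergraph n) {e} → T (degTest ℓ S H e) → Counted ℓ S H e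
degTest⁻ _ _ _ t =
  let he , t′ = to T-∧ t ; S⊆e , ∣e∣≡ℓ = to T-∧ t′
  in to T-≡ he , T-does⁻ (_ ⊆? _) S⊆e , ≡ᵇ⇒≡ _ _ ∣e∣≡ℓ

degTest⁺ : ∀ {n} ℓ S (H : Hypergraph n) {e} → Counted ℓ S H e → T (degTest ℓ S H e)
degTest⁺ _ _ _ (he , S⊆e , ∣e∣≡ℓ) =
  from T-∧ (from T-≡ he , from T-∧ (T-does⁺ (_ ⊆? _) S⊆e , ≡⇒≡ᵇ _ _ ∣e∣≡ℓ))

deg-≤1 : ∀ {n ℓ} {S : Subset n} (H : Hypergraph n) → ℓ ≤ ∣ S ∣ → deg ℓ S H ≤ 1
deg-≤1 {n} {ℓ} {S} H ℓ≤∣S∣ = count-≤1 (degTest ℓ S H) {U = S} (allSubsets-unique n) λ t →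
  let _ , S⊆e , ∣e∣≡ℓ = degTest⁻ ℓ S H t
  in sym (⊆∧∣∣≥⇒≡ S⊆e (subst (_≤ _) (sym ∣e∣≡ℓ) ℓ≤∣S∣))

δ-≤ : ∀ {n} s ℓ (H : Hypergraph n) {z : ℤ} → + 0 ℤ.≤ z →
      (∀ S → ∣ S ∣ ≡ s → + deg ℓ S H ℤ.≤ z) → + δ s ℓ H ℤ.≤ z
δ-≤ {n} s ℓ H {z} 0≤z bound =
  foldr-preservesᵇ {P = λ m → + m ℤ.≤ z} (⊔-closed (λ m → + m ℤ.≤ z)) 0≤z
    (All-map⁺ {f = λ S → deg ℓ S H}
      (All.map (λ {S} → bound S ∘ ≡ᵇ⇒≡ _ _) (all-filter (T? ∘ (λ S → ∣ S ∣ ≡ᵇ s)) (allSubsets n))))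

Refines : ∀ {n} → Hypergraph n → Hypergraph n → Set
Refines G H = ∀ {e} → IsEdge H e → ∃ λ e′ → IsEdge G e′ × e′ ⊆ e

refines-trans : ∀ {n} {G H K : Hypergraph n} → Refines G H → Refines H K → Refines G K
refines-trans G≼H H≼K he =
  let e′ , he′ , e′⊆e = H≼K he ; e″ , he″ , e″⊆e′ = G≼H he′
  in e″ , he″ , e′⊆e ∘ e″⊆e′

refines-proper : ∀ {n} {G H : Hypergraph n} {A : Set} {c : Fin n → A} →
                 Refines G H → ProperColoring G c → ProperColoring H c
refines-proper G≼H proper e he mono =
  let e′ , he′ , e′⊆e = G≼H he
  in proper e′ he′ λ u v u∈e′ v∈e′ → mono u v (e′⊆e u∈e′) (e′⊆e v∈e′)

LiftsAvoiding : ∀ {n} → Hypergraph n → Hypergraph n → Set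
LiftsAvoiding G H = ∀ {X w} → IsEdge G X → w ∉ X → ∃ λ X′ → IsEdge H X′ × X ⊆ X′ × w ∉ X′

lifts-triangleFree : ∀ {n} {G H : Hypergraph n} →
                     LiftsAvoiding G H → TriangleFree H → TriangleFree G
lifts-triangleFree lift free e f g u v w
  ((he , hf , hg) , _ , distinct , ((u∈e , v∈e) , (v∈f , w∈f) , (w∈g , u∈g)) , (¬u , ¬v , ¬w))
  with e′ , he′ , e⊆e′ , w∉e′ ← lift he (λ w∈e → ¬w (w∈e , w∈f , w∈g))
     | f′ , hf′ , f⊆f′ , u∉f′ ← lift hf (λ u∈f → ¬u (u∈e , u∈f , u∈g))
     | g′ , hg′ , g⊆g′ , v∉g′ ← lift hg (λ v∈g → ¬v (v∈e , v∈f , v∈g))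
  = free e′ f′ g′ u v w
      ( (he′ , hf′ , hg′)
      , (≢-sym (∈∧∉⇒≢ (f⊆f′ w∈f) w∉e′) , ≢-sym (∈∧∉⇒≢ (g⊆g′ u∈g) u∉f′) , ∈∧∉⇒≢ (e⊆e′ v∈e) v∉g′)
      , distinct
      , ((e⊆e′ u∈e , e⊆e′ v∈e) , (f⊆f′ v∈f , f⊆f′ w∈f) , (g⊆g′ w∈g , g⊆g′ u∈g))
      , (u∉f′ ∘ proj₁ ∘ proj₂ , v∉g′ ∘ proj₂ ∘ proj₂ , w∉e′ ∘ proj₁))

Heavy : ∀ {n} → ℕ → (ℤ → ℤ → ℤ) → Hypergraph n → ℕ → ℕ → Subset n → Set
Heavy k f H s ℓ S = ∣ S ∣ ≡ s × s < ℓ × ℓ ≤ k × f (+ s) (+ ℓ) ℤ.≤ + deg ℓ S H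

module Step {n} (k : ℕ) (f : ℤ → ℤ → ℤ) (H : Hypergraph n) (s : ℕ) where

  heavy⁻ : ∀ ℓ S → T (heavy k f H s ℓ S) → Heavy k f H s ℓ S
  heavy⁻ _ _ t =
    let ∣S∣≡s , t₁ = to T-∧ t ; s<ℓ , t₂ = to T-∧ t₁ ; ℓ≤k , f≤deg = to T-∧ t₂
    in ≡ᵇ⇒≡ _ _ ∣S∣≡s , <ᵇ⇒< _ _ s<ℓ , ≤ᵇ⇒≤ _ _ ℓ≤k , T-does⁻ (_ ℤ.≤? _) f≤deg

  heavy⁺ : ∀ ℓ S → Heavy k f H s ℓ S → T (heavy k f H s ℓ S)
  heavy⁺ _ _ (∣S∣≡s , s<ℓ , ℓ≤k , f≤deg) =
    from T-∧ (≡⇒≡ᵇ _ _ ∣S∣≡s , from T-∧ (<⇒<ᵇ s<ℓ , from T-∧ (≤⇒≤ᵇ ℓ≤k , T-does⁺ (_ ℤ.≤? _) f≤deg)))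

  added⁻ : ∀ {e} → T (added k f H s e) → ∃ λ ℓ → Heavy k f H s ℓ e
  added⁻ {e} t =
    let ℓ , h = satisfied (any⁻ (λ ℓ → heavy k f H s ℓ e) (upTo (suc k)) t) in ℓ , heavy⁻ ℓ e h

  added⁺ : ∀ {ℓ e} → Heavy k f H s ℓ e → T (added k f H s e)
  added⁺ {ℓ} {e} h@(_ , _ , ℓ≤k , _) =
    any⁺ (λ ℓ → heavy k f H s ℓ e) (lose (∈-upTo⁺ (s≤s ℓ≤k)) (heavy⁺ ℓ e h))

  removed⁻ : ∀ {e} → T (removed k f H s e) → ∃ λ S → S ⊆ e × Heavy k f H s ∣ e ∣ S
  removed⁻ {e} t =
    let S , t′ = satisfied (any⁻ (λ S → does (S ⊆? e) ∧ heavy k f H s ∣ e ∣ S) (allSubsets n) t)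
        S⊆e , h = to (T-∧ {does (S ⊆? e)}) t′
    in S , T-does⁻ (S ⊆? e) S⊆e , heavy⁻ ∣ e ∣ S h

  removed⁺ : ∀ {S e} → S ⊆ e → Heavy k f H s ∣ e ∣ S → T (removed k f H s e)
  removed⁺ {S} {e} S⊆e h = any⁺ (λ S → does (S ⊆? e) ∧ heavy k f H s ∣ e ∣ S)
    (lose (allSubsets-complete S) (from T-∧ (T-does⁺ (S ⊆? e) S⊆e , heavy⁺ ∣ e ∣ S h)))

  step⁻ : ∀ {e} → IsEdge (step k f H s) e →
          (IsEdge H e × ¬ T (removed k f H s e)) ⊎ ∃ λ ℓ → Heavy k f H s ℓ e
  step⁻ {e} he with to (T-∨ {H e ∧ not (removed k f H s e)}) (from T-≡ he)
  ... | inj₁ kept  = let he′ , ¬r = to T-∧ kept in inj₁ (to T-≡ he′ , T-not⁻ ¬r)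
  ... | inj₂ added = inj₂ (added⁻ {e} added)

  step⁺-kept : ∀ {e} → IsEdge H e → ¬ T (removed k f H s e) → IsEdge (step k f H s) e
  step⁺-kept {e} he ¬r =
    to T-≡ (from (T-∨ {y = added k f H s e}) (inj₁ (from T-∧ (from T-≡ he , T-not⁺ ¬r))))

  step⁺-added : ∀ {ℓ S} → Heavy k f H s ℓ S → IsEdge (step k f H s) S
  step⁺-added {ℓ} {S} h =
    to T-≡ (from (T-∨ {H S ∧ not (removed k f H s S)}) (inj₂ (added⁺ {ℓ} {S} h)))

  step-edge : ∀ {e} → IsEdge (step k f H s) e → ∣ e ∣ ≢ s → IsEdge H e
  step-edge he ∣e∣≢s with step⁻ he
  ... | inj₁ (he′ , _)       = he′
  ... | inj₂ (_ , ∣e∣≡s , _) = ⊥-elim (∣e∣≢s ∣e∣≡s)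

  heavy⇒¬step-edge : ∀ {S e} → S ⊆ e → Heavy k f H s ∣ e ∣ S → ¬ IsEdge (step k f H s) e
  heavy⇒¬step-edge {S} {e} S⊆e h@(_ , s<∣e∣ , _) he with step⁻ he
  ... | inj₁ (_ , ¬r)        = ¬r (removed⁺ {S} {e} S⊆e h)
  ... | inj₂ (_ , ∣e∣≡s , _) = <⇒≢ s<∣e∣ (sym ∣e∣≡s)

  step-refines : Refines (step k f H s) H
  step-refines {e} he with T? (removed k f H s e)
  ... | no ¬r = e , step⁺-kept he ¬r , λ x∈e → x∈e
  ... | yes r = let S , S⊆e , h = removed⁻ {e} r in S , step⁺-added h , S⊆e

  deg-step-≤ : ∀ {ℓ X} → ℓ ≢ s → deg ℓ X (step k f H s) ≤ deg ℓ X H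
  deg-step-≤ {ℓ} {X} ℓ≢s = count-mono _ _ (λ t →
    let he , X⊆e , ∣e∣≡ℓ = degTest⁻ ℓ X (step k f H s) t
    in degTest⁺ ℓ X H (step-edge he (ℓ≢s ∘ trans (sym ∣e∣≡ℓ)) , X⊆e , ∣e∣≡ℓ)) (allSubsets n)

  deg-step-heavy : ∀ {ℓ X} → Heavy k f H s ℓ X → deg ℓ X (step k f H s) ≡ 0
  deg-step-heavy {ℓ} {X} h =
    cong length (filter-none (T? ∘ degTest ℓ X (step k f H s)) {xs = allSubsets n} (All.universal uncounted _))
    where
    uncounted : ∀ e → ¬ T (degTest ℓ X (step k f H s) e)
    uncounted e t =
      let he , X⊆e , ∣e∣≡ℓ = degTest⁻ ℓ X (step k f H s) t
      in heavy⇒¬step-edge X⊆e (subst (λ m → Heavy k f H s m X) (sym ∣e∣≡ℓ) h) he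

stage-refines : ∀ {n} k f (F : Hypergraph n) i → Refines (reductionStage k f F i) F
stage-refines k f F zero    he = _ , he , λ x∈e → x∈e
stage-refines k f F (suc i)    =
  refines-trans (Step.step-refines k f (reductionStage k f F i) (k ∸ suc i)) (stage-refines k f F i)

module Threshold (k : ℕ) (f : ℤ → ℤ → ℤ) (f-diag : ∀ ℓ → f ℓ ℓ ≡ + 1)
                 (f-anti : ∀ s₁ s₂ ℓ → s₂ ℤ.< s₁ → f s₁ ℓ ℤ.< f s₂ ℓ) where

  1<f : ∀ {s ℓ} → s < ℓ → + 1 ℤ.< f (+ s) (+ ℓ)
  1<f {s} {ℓ} s<ℓ = subst (ℤ._< f (+ s) (+ ℓ)) (f-diag (+ ℓ)) (f-anti (+ ℓ) (+ s) (+ ℓ) (ℤ.+<+ s<ℓ))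

  0<f : ∀ {s ℓ} → s < ℓ → + 0 ℤ.< f (+ s) (+ ℓ)
  0<f s<ℓ = ℤₚ.<-trans (ℤ.+<+ (s≤s z≤n)) (1<f s<ℓ)

  record Sparse {n} (H : Hypergraph n) (m : ℕ) : Set where
    field
      deg<f : ∀ {s ℓ} X → ∣ X ∣ ≡ s → m ≤ s → s < ℓ → ℓ ≤ k → + deg ℓ X H ℤ.< f (+ s) (+ ℓ)

  open Sparse

  sparse-mono : ∀ {n} {H : Hypergraph n} {m m′} → m ≤ m′ → Sparse H m → Sparse H m′
  deg<f (sparse-mono m≤m′ sparse) X ∣X∣≡s m′≤s = deg<f sparse X ∣X∣≡s (ℕₚ.≤-trans m≤m′ m′≤s)

  step-sparse : ∀ {n} {H : Hypergraph n} {s} → Sparse H (suc s) → Sparse (step k f H s) s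
  deg<f (step-sparse {H = H} {s} sparse) {s′} {ℓ} X ∣X∣≡s′ s≤s′ s′<ℓ ℓ≤k with ℕₚ.m≤n⇒m<n∨m≡n s≤s′
  ... | inj₁ s<s′ =
    ℤₚ.≤-<-trans (ℤ.+≤+ (Step.deg-step-≤ k f H s {ℓ} {X} (<⇒≢ (ℕₚ.<-trans s<s′ s′<ℓ) ∘ sym)))
                 (deg<f sparse X ∣X∣≡s′ s<s′ s′<ℓ ℓ≤k)
  ... | inj₂ refl with f (+ s) (+ ℓ) ℤ.≤? + deg ℓ X H
  ...   | yes f≤deg =
    subst (λ d → + d ℤ.< f (+ s) (+ ℓ))
          (sym (Step.deg-step-heavy k f H s {ℓ} {X} (∣X∣≡s′ , s′<ℓ , ℓ≤k , f≤deg))) (0<f s′<ℓ)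
  ...   | no  f≰deg =
    ℤₚ.≤-<-trans (ℤ.+≤+ (Step.deg-step-≤ k f H s {ℓ} {X} (<⇒≢ s′<ℓ ∘ sym))) (ℤₚ.≰⇒> f≰deg)

  stage-sparse : ∀ {n} (F : Hypergraph n) i → Sparse (reductionStage k f F i) (k ∸ i)
  deg<f (stage-sparse F zero) _ refl k≤s s<ℓ ℓ≤k = ⊥-elim (<⇒≱ (ℕₚ.<-≤-trans s<ℓ ℓ≤k) k≤s)
  stage-sparse F (suc i) = step-sparse (sparse-mono (m∸n≤1+[m∸1+n] k i) (stage-sparse F i))

  sparse⇒δ≤f : ∀ {n} {H : Hypergraph n} {m} → Sparse H m →
               ∀ s ℓ → m ≤ s → s < ℓ → ℓ ≤ k → + δ s ℓ H ℤ.≤ f (+ s) (+ ℓ)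
  sparse⇒δ≤f {H = H} sparse s ℓ m≤s s<ℓ ℓ≤k =
    δ-≤ s ℓ H (ℤₚ.<⇒≤ (0<f s<ℓ)) λ S ∣S∣≡s → ℤₚ.<⇒≤ (deg<f sparse S ∣S∣≡s m≤s s<ℓ ℓ≤k)

  deg-superset-< : ∀ {n} {H : Hypergraph n} {s ℓ} {X Y : Subset n} → Sparse H (suc s) →
                   X ⊂ Y → ∣ X ∣ ≡ s → s < ℓ → ℓ ≤ k → + deg ℓ Y H ℤ.< f (+ s) (+ ℓ)
  deg-superset-< {H = H} {s} {ℓ} {Y = Y} sparse X⊂Y refl s<ℓ ℓ≤k with ∣ Y ∣ ℕₚ.<? ℓ
  ... | yes ∣Y∣<ℓ =
    ℤₚ.<-trans (deg<f sparse Y refl ∣X∣<∣Y∣ ∣Y∣<ℓ ℓ≤k) (f-anti _ _ (+ ℓ) (ℤ.+<+ ∣X∣<∣Y∣))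
    where ∣X∣<∣Y∣ = p⊂q⇒∣p∣<∣q∣ X⊂Y
  ... | no  ∣Y∣≮ℓ = ℤₚ.≤-<-trans (ℤ.+≤+ (deg-≤1 {S = Y} H (ℕₚ.≮⇒≥ ∣Y∣≮ℓ))) (1<f s<ℓ)

  step-lifts : ∀ {n} {H : Hypergraph n} {s} → Sparse H (suc s) → LiftsAvoiding (step k f H s) H
  step-lifts {n} {H} {s} sparse {X} {w} he w∉X with Step.step⁻ k f H s he
  ... | inj₁ (he′ , _) = X , he′ , (λ x∈X → x∈X) , w∉X
  ... | inj₂ (ℓ , ∣X∣≡s , s<ℓ , ℓ≤k , f≤deg) =
    let e , countedX , ¬countedY =
          count-<⇒witness (degTest ℓ X H) (degTest ℓ Y H) (allSubsets n) deg-Y<deg-X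
        he , X⊆e , ∣e∣≡ℓ = degTest⁻ ℓ X H countedX
    in e , he , X⊆e , λ w∈e → ¬countedY (degTest⁺ ℓ Y H (he , ∪⁅⁆-⊆ X⊆e w∈e , ∣e∣≡ℓ))
    where
    Y = X ∪ ⁅ w ⁆
    X⊂Y : X ⊂ Y
    X⊂Y = p⊆p∪q ⁅ w ⁆ , w , q⊆p∪q X ⁅ w ⁆ (x∈⁅x⁆ w) , w∉X
    deg-Y<deg-X : deg ℓ Y H < deg ℓ X H
    deg-Y<deg-X = ℤₚ.drop‿+<+ (ℤₚ.<-≤-trans (deg-superset-< sparse X⊂Y ∣X∣≡s s<ℓ ℓ≤k) f≤deg)

  stage-triangleFree : ∀ {n} {F : Hypergraph n} → TriangleFree F →
                       ∀ i → TriangleFree (reductionStage k f F i)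
  stage-triangleFree free zero    = free
  stage-triangleFree {F = F} free (suc i) =
    lifts-triangleFree (step-lifts (sparse-mono (m∸n≤1+[m∸1+n] k i) (stage-sparse F i)))
                       (stage-triangleFree free i)

proposition3p2 : (k : ℕ) → 3 ≤ k → (f : ℤ → ℤ → ℤ) →
    (∀ ℓ → f ℓ ℓ ≡ + 1) →
    (∀ s₁ s₂ ℓ → s₂ ℤ.< s₁ → f s₁ ℓ ℤ.< f s₂ ℓ) →
    ∀ {n} (F : Hypergraph n) → Rank k F →
    ((∀ s ℓ → 2 ≤ s → s < ℓ → ℓ ≤ k → + δ s ℓ (reduction k f F) ℤ.≤ f (+ s) (+ ℓ))
      × (∀ {A : Set} (c : Fin n → A) → ProperColoring (reduction k f F) c → ProperColoring F c))
    × (TriangleFree F → TriangleFree (reduction k f F))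
proposition3p2 k 3≤k f f-diag f-anti F _ =
  (sparse⇒δ≤f reduction-sparse , λ _ → refines-proper (stage-refines k f F (k ∸ 2))) ,
  λ free → stage-triangleFree free (k ∸ 2)
  where
  open Threshold k f f-diag f-anti
  reduction-sparse : Sparse (reduction k f F) 2
  reduction-sparse = subst (Sparse (reduction k f F)) (m∸[m∸n]≡n (ℕₚ.≤-trans (ℕₚ.n≤1+n 2) 3≤k))
                           (stage-sparse F (k ∸ 2))
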